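{- Let $M$ be a $\lambda$-term, let $(\Pi,E)$ be a pseudo-derivation for $M$, let $(\bar{\mathsf e},\psi)$ be a solution of $(\Pi,E)$, and suppose that the root of $\bar{\mathsf e}(\Pi)$ is the judgement $\mathtt{\Gamma}\vdash_{\tt p} M:{\tt a}$. Then for every substitution $\phi:\mathbf V\to\mathbf T$, the tree $\phi\circ\mathsf m\circ\psi\circ\bar{\mathsf e}(\Pi)$ is a derivation in system $\mathcal N$ of the judgement $\phi(\mathsf m(\psi(\mathtt{\Gamma})))\vdash M:\phi(\mathsf m(\psi({\tt a})))$.
   Context: $\lambda$-terms: $M,N::=x\mid\lambda x.M\mid MN$. Intersection types $\mathbf T$: $A::=a\mid\mu\to A$, with $a$ in a countable set $\mathbf V$ of type variables and $\mu=[A_1,\dots,A_n]$ ($n\ge0$) a finite multiset of types. A type environment $\Gamma$ maps term variables to multisets, all but finitely many to $[\,]$; $\mathrm{dom}(\Gamma)=\{x\mid\Gamma(x)\neq[\,]\}$; $(\Gamma\uplus\Delta)(x)=\Gamma(x)\uplus\Delta(x)$ (multiset union); $\Gamma\setminus x$ agrees with $\Gamma$ except that it maps $x$ to $[\,]$. System $\mathcal N$ has rules: (var) $x:[A]\vdash x:A$; (abs) from $\Gamma\vdash M:A$ infer $\Gamma\setminus x\vdash\lambda x.M:\Gamma(x)\to A$; (many) from $\Gamma_i\vdash M:A_i$ ($1\le i\le n$, $n\ge0$) infer $\biguplus_i\Gamma_i\vdash M:[A_1,\dots,A_n]$; (app) from $\Gamma\vdash M:\mu\to A$ and $\Delta\vdash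 N:\mu$ infer $\Gamma\uplus\Delta\vdash MN:A$. Pre-types: ${\tt A}::={\tt a}\mid\sigma\to{\tt A}$, with ${\tt a}$ in a countable set $\mathbf V_{\tt p}$ of pre-type variables and $\sigma=\langle{\tt A}_1,\dots,{\tt A}_n\rangle$ ($n\ge0$) a finite ordered list; $|\sigma|$ is its length, $\cdot$ is concatenation. Pre-type environments $\mathtt\Gamma$ map term variables to lists (all but finitely many empty), with pointwise concatenation $\mathtt\Gamma\cdot\mathtt\Delta$ and the analogous notations $\mathrm{dom}$, $\mathtt\Gamma\setminus x$. Objects are disjoint if they share no pre-type variable; fresh means occurring nowhere else. A pseudo-derivation for $M$ is a pair $(\Pi,E_\Pi)$, $\Pi$ a tree with ordered premises and $E_\Pi$ a set of equations between pre-types or between lists, built by: (var) $x:\langle{\tt a}\rangle\vdash_{\tt p}x:{\tt a}$, $E=\emptyset$; (abs) from $\Sigma\triangleright\mathtt\Gamma\vdash_{\tt p}M:{\tt a}$, ${\tt b}$ fresh, infer $\mathtt\Gamma\setminus x\vdash_{\tt p}\lambda x.M:{\tt b}$, $E=E_\Sigma\cup\{{\tt b}\doteq\mathtt\Gamma(x)\to{\tt a}\}$; (many) from pairwise disjoint $\Sigma_i\triangleright\mathtt\Gamma_i\vdash_{\tt p}M:{\tt a}_i$ ($1\le i\le n$, $n\ge0$) infer $\mathtt\Gamma_1\cdot\ldots\cdot\mathtt\Gamma_n\vdash_{\tt p}M:\langle{\tt a}_1,\dots,{\tt a}_n\rangle$, $E=\bigcup_iE_{\Sigma_i}$; (app)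 from disjoint $\Sigma_1\triangleright\mathtt\Gamma\vdash_{\tt p}M:{\tt a}$ and $\Sigma_2\triangleright\mathtt\Delta\vdash_{\tt p}N:\langle{\tt b}_1,\dots,{\tt b}_n\rangle$, ${\tt c}$ fresh, infer $\mathtt\Gamma\cdot\mathtt\Delta\vdash_{\tt p}MN:{\tt c}$, $E=E_{\Sigma_1}\cup E_{\Sigma_2}\cup\{{\tt a}\doteq\langle{\tt b}_1,\dots,{\tt b}_n\rangle\to{\tt c}\}$. Pseudo-derivations are taken modulo renaming of pre-type variables. The minimal pseudo-derivation $\mathrm{PD}_{\min}(M)$ is the one with $n=1$ in every (many) rule. A substitution $\psi:\mathbf V_{\tt p}\to$ pre-types (resp. $\phi:\mathbf V\to\mathbf T$) is extended homomorphically to lists, environments and trees; $\psi$ solves a set of equations if it makes both sides of each equation equal. The map $\mathsf m$ sends pre-types to types: $\mathsf m({\tt a})=a$ (injective on variables), $\mathsf m(\sigma\to{\tt A})=\mathsf m(\sigma)\to\mathsf m({\tt A})$, $\mathsf m(\langle{\tt A}_1,\dots,{\tt A}_n\rangle)=[\mathsf m({\tt A}_1),\dots,\mathsf m({\tt A}_n)]$, extended to environments and trees. Expansion $\mathsf{Exp}(\sigma,n)$ ($\sigma\neq\langle\rangle$, $n\ge1$): if $\sigma=\langle{\tt a}_1,\dots,{\tt a}_m\rangle$ is the list in the conclusion of a (many) rule of $\Pi$ with subject $N$, replace the subtree rooted there by a (many) rule whose $m+n$ premises are fresh pairwise disjoint copies $\Sigma_i\triangleright\mathtt\Gamma_i\vdash_{\tt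 p}N:{\tt a}_i$ ($1\le i\le m+n$) of $\mathrm{PD}_{\min}(N)$, recomputing the equations; otherwise leave $\Pi$ unchanged. Erasure $\mathsf{Er}(\sigma,n)$: the same, but with $\max(m-n,0)$ such premises. A solution of a pseudo-derivation $(\Pi,E)$ is a pair $(\bar{\mathsf e},\psi)$ where $\bar{\mathsf e}$ is a finite sequence of expansions and erasures and $\psi$ solves the equation set of $\bar{\mathsf e}(\Pi,E)$. -}

module Defs where

open import Data.Nat using (ℕ; _≤_; _+_; _∸_; _≡ᵇ_)
open import Data.Bool using (if_then_else_)
open import Data.List using (List; []; _∷_; _++_; map; foldr; length; take)
open import Data.List.Relation.Unary.All using (All)
open import Data.List.Relation.Unary.Any using (Any)
open import Data.List.Relation.Unary.AllPairs using (AllPairs)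
open import Data.List.Relation.Binary.Permutation.Homogeneous using (Permutation)
open import Data.Product using (Σ; _×_; _,_; proj₁; proj₂)
open import Data.Sum using (_⊎_)
open import Data.Empty using (⊥)
open import Relation.Nullary using (¬_)
open import Relation.Binary.PropositionalEquality using (_≡_)

data Term : Set where
  v   : ℕ → Term
  ƛ   : ℕ → Term → Term
  _·_ : Term → Term → Term

-- Intersection types T :  A ::= a | μ → A,  μ a finite multiset,
-- represented by a list; multiset equality is handled by _≈T_ / _≈M_.

data Ty : Set where
  tv  : ℕ → Ty
  _⇒_ : List Ty → Ty → Ty

data _≈T_ : Ty → Ty → Set where
  tv  : ∀ {k} → tv k ≈T tv k
  arr : ∀ {μ ν A B} → Permutation _≈T_ μ ν → A ≈T B → (μ ⇒ A) ≈T (ν ⇒ B)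

_≈M_ : List Ty → List Ty → Set
_≈M_ = Permutation _≈T_

data PTy : Set where
  pv  : ℕ → PTy
  _⇒_ : List PTy → PTy → PTy

Env : Set → Set
Env T = ℕ → List T

sing : {T : Set} → ℕ → T → Env T
sing x A y = if y ≡ᵇ x then A ∷ [] else []

_∖_ : {T : Set} → Env T → ℕ → Env T
(Γ ∖ x) y = if y ≡ᵇ x then [] else Γ y

-- pointwise concatenation (for N-environments it represents ⊎)
_·E_ : {T : Set} → Env T → Env T → Env T
(Γ ·E Δ) y = Γ y ++ Δ y

emptyE : {T : Set} → Env T
emptyE _ = []

concatE : {T : Set} → List (Env T) → Env T
concatE = foldr _·E_ emptyE

_≈E_ : Env Ty → Env Ty → Set
Γ ≈E Δ = ∀ y → Γ y ≈M Δ y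

-- DTree: a node whose conclusion is  Γ ⊢ M : A  (rules var / abs / app)
-- DMany: a (many) node whose conclusion is  Γ ⊢ N : ⟨A₁,…,Aₙ⟩
-- The subject of a node is determined by the rule and its premises,
-- except for (many) nodes, which record their subject explicitly.

data DTree (T : Set) : Set
data DMany (T : Set) : Set

data DTree T where
  var : Env T → ℕ → T → DTree T
  abs : Env T → ℕ → T → DTree T → DTree T
  app : Env T → T → DTree T → DMany T → DTree T

data DMany T where
  many : Env T → Term → List T → List (DTree T) → DMany T

module _ {T : Set} where
  env : DTree T → Env T
  env (var Γ _ _) = Γ
  env (abs Γ _ _ _) = Γ
  env (app Γ _ _ _) = Γ

  ty : DTree T → T
  ty (var _ _ A) = A
  ty (abs _ _ A _) = A
  ty (app _ A _ _) = A

  menv : DMany T → Env T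
  menv (many Γ _ _ _) = Γ

  msubj : DMany T → Term
  msubj (many _ N _ _) = N

  mty : DMany T → List T
  mty (many _ _ σ _) = σ

  subj : DTree T → Term
  subj (var _ x _) = v x
  subj (abs _ x _ t) = ƛ x (subj t)
  subj (app _ _ t f) = subj t · msubj f

module _ {T U : Set} (g : T → U) where
  mapE : Env T → Env U
  mapE Γ y = map g (Γ y)

  mapT : DTree T → DTree U
  mapM : DMany T → DMany U
  mapL : List (DTree T) → List (DTree U)
  mapT (var Γ x A) = var (mapE Γ) x (g A)
  mapT (abs Γ x A t) = abs (mapE Γ) x (g A) (mapT t)
  mapT (app Γ A t f) = app (mapE Γ) (g A) (mapT t) (mapM f)
  mapM (many Γ N σ ts) = many (mapE Γ) N (map g σ) (mapL ts)
  mapL [] = []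
  mapL (t ∷ ts) = mapT t ∷ mapL ts

data DerN : DTree Ty → Set
data DerM : DMany Ty → Set

data DerN where
  var : ∀ {Γ x A} → Γ ≈E sing x A → DerN (var Γ x A)
  abs : ∀ {Γ x A t} → DerN t → Γ ≈E (env t ∖ x) → A ≈T (env t x ⇒ ty t)
      → DerN (abs Γ x A t)
  app : ∀ {Γ A t f} → DerN t → DerM f → ty t ≈T (mty f ⇒ A)
      → Γ ≈E (env t ·E menv f) → DerN (app Γ A t f)

data DerM where
  many : ∀ {Γ N μ ts} → All DerN ts → All (λ t → subj t ≡ N) ts
       → μ ≈M map ty ts → Γ ≈E concatE (map env ts) → DerM (many Γ N μ ts)

substP : (ℕ → PTy) → PTy → PTy
substPL : (ℕ → PTy) → List PTy → List PTy
substP ψ (pv k) = ψ k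
substP ψ (σ ⇒ A) = substPL ψ σ ⇒ substP ψ A
substPL ψ [] = []
substPL ψ (A ∷ σ) = substP ψ A ∷ substPL ψ σ

substT : (ℕ → Ty) → Ty → Ty
substTL : (ℕ → Ty) → List Ty → List Ty
substT φ (tv k) = φ k
substT φ (μ ⇒ A) = substTL φ μ ⇒ substT φ A
substTL φ [] = []
substTL φ (A ∷ μ) = substT φ A ∷ substTL φ μ

m : PTy → Ty
mL : List PTy → List Ty
m (pv k) = tv k
m (σ ⇒ A) = mL σ ⇒ m A
mL [] = []
mL (A ∷ σ) = m A ∷ mL σ

data OccP (k : ℕ) : PTy → Set where
  here : OccP k (pv k)
  dom  : ∀ {σ A} → Any (OccP k) σ → OccP k (σ ⇒ A)
  cod  : ∀ {σ A} → OccP k A → OccP k (σ ⇒ A)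

OccEnv : ℕ → Env PTy → Set
OccEnv k Γ = Σ ℕ λ y → Any (OccP k) (Γ y)

data OccT (k : ℕ) : DTree PTy → Set
data OccM (k : ℕ) : DMany PTy → Set

data OccT k where
  inEnv : ∀ {t} → OccEnv k (env t) → OccT k t
  inTy  : ∀ {t} → OccP k (ty t) → OccT k t
  inAbs : ∀ {Γ x A t} → OccT k t → OccT k (abs Γ x A t)
  inAppL : ∀ {Γ A t f} → OccT k t → OccT k (app Γ A t f)
  inAppR : ∀ {Γ A t f} → OccM k f → OccT k (app Γ A t f)

data OccM k where
  inEnv : ∀ {f} → OccEnv k (menv f) → OccM k f
  inTy  : ∀ {f} → Any (OccP k) (mty f) → OccM k f
  inPrem : ∀ {Γ N σ ts} → Any (OccT k) ts → OccM k (many Γ N σ ts)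

DisjT : DTree PTy → DTree PTy → Set
DisjT s t = ∀ k → OccT k s → OccT k t → ⊥

DisjTM : DTree PTy → DMany PTy → Set
DisjTM s f = ∀ k → OccT k s → OccM k f → ⊥

-- Pseudo-derivations (the tree part; equations are computed by eqs)

_≗E_ : {T : Set} → Env T → Env T → Set
Γ ≗E Δ = ∀ y → Γ y ≡ Δ y

data PD : DTree PTy → Set
data PDM : DMany PTy → Set

data PD where
  var : ∀ {Γ x k} → Γ ≗E sing x (pv k) → PD (var Γ x (pv k))
  abs : ∀ {Γ x k t} → PD t → ¬ OccT k t → Γ ≗E (env t ∖ x)
      → PD (abs Γ x (pv k) t)
  app : ∀ {Γ k t f} → PD t → PDM f → DisjTM t f → ¬ OccT k t → ¬ OccM k f
      → Γ ≗E (env t ·E menv f) → PD (app Γ (pv k) t f)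

-- every conclusion type of a PD node is a variable (enforced by the
-- constructors above); (many) premises have variable types as well
data PDM where
  many : ∀ {Γ N σ ts} → All PD ts → All (λ t → subj t ≡ N) ts
       → AllPairs DisjT ts → σ ≡ map ty ts → Γ ≗E concatE (map env ts)
       → PDM (many Γ N σ ts)

IsPD : Term → DTree PTy → Set
IsPD M Π = PD Π × subj Π ≡ M

eqs  : DTree PTy → List (PTy × PTy)
eqsM : DMany PTy → List (PTy × PTy)
eqsL : List (DTree PTy) → List (PTy × PTy)
eqs (var _ _ _) = []
eqs (abs _ x b t) = (b , (env t x ⇒ ty t)) ∷ eqs t
eqs (app _ c t f) = (ty t , (mty f ⇒ c)) ∷ (eqs t ++ eqsM f)
eqsM (many _ _ _ ts) = eqsL ts
eqsL [] = []
eqsL (t ∷ ts) = eqs t ++ eqsL ts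

Solves : (ℕ → PTy) → List (PTy × PTy) → Set
Solves ψ E = All (λ e → substP ψ (proj₁ e) ≡ substP ψ (proj₂ e)) E

data MinT : DTree PTy → Set
data MinM : DMany PTy → Set
data MinT where
  var : ∀ {Γ x A} → MinT (var Γ x A)
  abs : ∀ {Γ x A t} → MinT t → MinT (abs Γ x A t)
  app : ∀ {Γ A t f} → MinT t → MinM f → MinT (app Γ A t f)
data MinM where
  many : ∀ {Γ N σ t} → MinT t → MinM (many Γ N σ (t ∷ []))

-- a fresh copy of PD_min(N) (pseudo-derivations are up to renaming)
IsMinPD : Term → DTree PTy → Set
IsMinPD N t = IsPD N t × MinT t

data HasT (σ : List PTy) : DTree PTy → Set
data HasM (σ : List PTy) : DMany PTy → Set
data HasT σ where
  inAbs  : ∀ {Γ x A t} → HasT σ t → HasT σ (abs Γ x A t)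
  inAppL : ∀ {Γ A t f} → HasT σ t → HasT σ (app Γ A t f)
  inAppR : ∀ {Γ A t f} → HasM σ f → HasT σ (app Γ A t f)
data HasM σ where
  here   : ∀ {Γ N ts} → HasM σ (many Γ N σ ts)
  inPrem : ∀ {Γ N μ ts} → Any (HasT σ) ts → HasM σ (many Γ N μ ts)

-- RepT σ k Π Π' : Π' is Π where the (many) node with conclusion list
-- σ = ⟨a₁,…,a_m⟩ and subject N is replaced by a (many) node with k
-- premises, copies of PD_min(N) whose i-th conclusion is aᵢ for
-- i ≤ min(m,k); the judgements of the ancestors are recomputed
-- (ancestor environments / (many) lists are left free here and are
-- fixed by requiring that the result be a pseudo-derivation, which
-- also enforces freshness of the new copies).
data RepT (σ : List PTy) (k : ℕ) : DTree PTy → DTree PTy → Set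
data RepM (σ : List PTy) (k : ℕ) : DMany PTy → DMany PTy → Set
data RepL (σ : List PTy) (k : ℕ) : List (DTree PTy) → List (DTree PTy) → Set

data RepT σ k where
  inAbs  : ∀ {Γ Γ' x A t t'} → RepT σ k t t' → RepT σ k (abs Γ x A t) (abs Γ' x A t')
  inAppL : ∀ {Γ Γ' A t t' f} → RepT σ k t t' → RepT σ k (app Γ A t f) (app Γ' A t' f)
  inAppR : ∀ {Γ Γ' A t f f'} → RepM σ k f f' → RepT σ k (app Γ A t f) (app Γ' A t f')

data RepM σ k where
  here   : ∀ {Γ Γ' N σ' ts ts'} → length ts' ≡ k → All (IsMinPD N) ts'
         → σ' ≡ map ty ts' → take (length σ) σ' ≡ take k σ
         → RepM σ k (many Γ N σ ts) (many Γ' N σ' ts')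
  inPrem : ∀ {Γ Γ' N μ μ' ts ts'} → RepL σ k ts ts'
         → RepM σ k (many Γ N μ ts) (many Γ' N μ' ts')

data RepL σ k where
  here  : ∀ {t t' ts} → RepT σ k t t' → RepL σ k (t ∷ ts) (t' ∷ ts)
  there : ∀ {t ts ts'} → RepL σ k ts ts' → RepL σ k (t ∷ ts) (t ∷ ts')

data Kind : Set where
  expK erK : Kind

record Op : Set where
  constructor op
  field
    kind : Kind
    lst  : List PTy
    num  : ℕ
    lst≢[] : ¬ (lst ≡ [])
    1≤num  : 1 ≤ num

-- number of premises of the new (many) node
target : Kind → List PTy → ℕ → ℕ
target expK σ n = length σ + n
target erK  σ n = length σ ∸ n

-- Step o Π Π' : Π' is (a choice of fresh names for) o(Π)
Step : Op → DTree PTy → DTree PTy → Set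
Step (op κ σ n _ _) Π Π' =
  (RepT σ (target κ σ n) Π Π' × PD Π') ⊎ (¬ HasT σ Π × Π' ≡ Π)

-- Steps ē Π Π' : Π' is ē(Π) (the operations applied from left to right)
data Steps : List Op → DTree PTy → DTree PTy → Set where
  []  : ∀ {Π} → Steps [] Π Π
  _∷_ : ∀ {o os Π Π₁ Π₂} → Step o Π Π₁ → Steps os Π₁ Π₂ → Steps (o ∷ os) Π Π₂

{-# OPTIONS --safe #-}
module Submission where

-- A pseudo-derivation records every premise of a rule of system 𝒩 except the
-- type equalities of (abs) and (app), which it defers to the equations E.  Any
-- map g from pre-types to types that commutes with the arrow constructor
-- commutes with all the bookkeeping on environments, subjects and (many)
-- lists, so once g equates the two sides of every equation, applying g to a
-- pseudo-derivation yields a derivation of 𝒩.  The map φ ∘ m ∘ ψ is such a g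
-- whenever ψ solves E.  Expansions and erasures only replace a (many) subtree
-- by one with the same subject, and a step that changes the tree is required
-- to produce a pseudo-derivation again, so ē(Π) is a pseudo-derivation for M.

open import Defs
open import Data.Nat using (ℕ; _≡ᵇ_)
open import Data.Bool using (true; false)
open import Data.List using (List; []; _∷_; _++_; map)
open import Data.List.Properties using (map-++)
open import Data.List.Relation.Unary.All using (All; []; _∷_)
import Data.List.Relation.Unary.All as All
open import Data.List.Relation.Unary.All.Properties using (++⁻)
open import Data.List.Relation.Binary.Pointwise.Base using (Pointwise; []; _∷_)
import Data.List.Relation.Binary.Permutation.Homogeneous as Permutation
open import Data.Product using (_×_; _,_; proj₁; proj₂)
open import Data.Sum using (inj₁; inj₂)
open import Function using (_∘_; _$_)
open import Relation.Binary.PropositionalEquality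
  using (_≡_; refl; sym; trans; cong; cong₂; module ≡-Reasoning)

≈T-refl : ∀ A → A ≈T A
≈T-refl-Pointwise : ∀ μ → Pointwise _≈T_ μ μ
≈T-refl (tv k) = tv
≈T-refl (μ ⇒ A) = arr (Permutation.refl (≈T-refl-Pointwise μ)) (≈T-refl A)
≈T-refl-Pointwise [] = []
≈T-refl-Pointwise (A ∷ μ) = ≈T-refl A ∷ ≈T-refl-Pointwise μ

≡⇒≈T : ∀ {A B} → A ≡ B → A ≈T B
≡⇒≈T {A} refl = ≈T-refl A

≡⇒≈M : ∀ {μ ν} → μ ≡ ν → μ ≈M ν
≡⇒≈M {μ} refl = Permutation.refl (≈T-refl-Pointwise μ)

≗E⇒≈E : ∀ {Γ Δ} → Γ ≗E Δ → Γ ≈E Δ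
≗E⇒≈E Γ≗Δ y = ≡⇒≈M (Γ≗Δ y)

module _ {T U : Set} (g : T → U) where

  mapE-sing : ∀ x A → mapE g (sing x A) ≗E sing x (g A)
  mapE-sing x A y with y ≡ᵇ x
  ... | true  = refl
  ... | false = refl

  mapE-∖ : ∀ Γ x → mapE g (Γ ∖ x) ≗E (mapE g Γ ∖ x)
  mapE-∖ Γ x y with y ≡ᵇ x
  ... | true  = refl
  ... | false = refl

  mapE-concatE : ∀ Γs → mapE g (concatE Γs) ≗E concatE (map (mapE g) Γs)
  mapE-concatE [] y = refl
  mapE-concatE (Γ ∷ Γs) y =
    trans (map-++ g (Γ y) (concatE Γs y)) (cong (map g (Γ y) ++_) (mapE-concatE Γs y))

  env-mapT : ∀ t → env (mapT g t) ≡ mapE g (env t)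
  env-mapT (var _ _ _)   = refl
  env-mapT (abs _ _ _ _) = refl
  env-mapT (app _ _ _ _) = refl

  ty-mapT : ∀ t → ty (mapT g t) ≡ g (ty t)
  ty-mapT (var _ _ _)   = refl
  ty-mapT (abs _ _ _ _) = refl
  ty-mapT (app _ _ _ _) = refl

  subj-mapT : ∀ t → subj (mapT g t) ≡ subj t
  subj-mapT (var _ _ _)               = refl
  subj-mapT (abs _ x _ t)             = cong (ƛ x) (subj-mapT t)
  subj-mapT (app _ _ t (many _ _ _ _)) = cong (_· _) (subj-mapT t)

  menv-mapM : ∀ f → menv (mapM g f) ≡ mapE g (menv f)
  menv-mapM (many _ _ _ _) = refl

  mty-mapM : ∀ f → mty (mapM g f) ≡ map g (mty f)
  mty-mapM (many _ _ _ _) = refl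

  env-mapL : ∀ ts → map env (mapL g ts) ≡ map (mapE g) (map env ts)
  env-mapL []       = refl
  env-mapL (t ∷ ts) = cong₂ _∷_ (env-mapT t) (env-mapL ts)

  ty-mapL : ∀ ts → map ty (mapL g ts) ≡ map g (map ty ts)
  ty-mapL []       = refl
  ty-mapL (t ∷ ts) = cong₂ _∷_ (ty-mapT t) (ty-mapL ts)

  subj-mapL : ∀ {N ts} → All (λ t → subj t ≡ N) ts → All (λ t → subj t ≡ N) (mapL g ts)
  subj-mapL {ts = []}     []       = []
  subj-mapL {ts = t ∷ ts} (e ∷ es) = trans (subj-mapT t) e ∷ subj-mapL es

ArrowHom : (PTy → Ty) → Set
ArrowHom g = ∀ σ A → g (σ ⇒ A) ≡ map g σ ⇒ g A

Unifies : (PTy → Ty) → List (PTy × PTy) → Set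
Unifies g E = All (λ e → g (proj₁ e) ≡ g (proj₂ e)) E

module _ (g : PTy → Ty) (g-⇒ : ArrowHom g) where
  open ≡-Reasoning

  PD⇒DerN : ∀ {t} → PD t → Unifies g (eqs t) → DerN (mapT g t)
  PDM⇒DerM : ∀ {f} → PDM f → Unifies g (eqsM f) → DerM (mapM g f)
  All-PD⇒DerN : ∀ {ts} → All PD ts → Unifies g (eqsL ts) → All DerN (mapL g ts)

  PD⇒DerN (var {Γ} {x} {k} Γ≗) _ =
    var (≗E⇒≈E λ y → trans (cong (map g) (Γ≗ y)) (mapE-sing g x (pv k) y))
  PD⇒DerN (abs {Γ} {x} {k} {t} d _ Γ≗) (b≐ ∷ E) =
    abs (PD⇒DerN d E) (≗E⇒≈E env≗) (≡⇒≈T ty≡)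
    where
    env≗ : mapE g Γ ≗E (env (mapT g t) ∖ x)
    env≗ y = begin
      map g (Γ y)                  ≡⟨ cong (map g) (Γ≗ y) ⟩
      map g ((env t ∖ x) y)        ≡⟨ mapE-∖ g (env t) x y ⟩
      (mapE g (env t) ∖ x) y       ≡⟨ cong (λ Δ → (Δ ∖ x) y) (env-mapT g t) ⟨
      (env (mapT g t) ∖ x) y       ∎
    ty≡ : g (pv k) ≡ env (mapT g t) x ⇒ ty (mapT g t)
    ty≡ = begin
      g (pv k)                          ≡⟨ b≐ ⟩
      g (env t x ⇒ ty t)                ≡⟨ g-⇒ (env t x) (ty t) ⟩
      map g (env t x) ⇒ g (ty t)        ≡⟨ cong₂ _⇒_ (cong (_$ x) (env-mapT g t)) (ty-mapT g t) ⟨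
      env (mapT g t) x ⇒ ty (mapT g t)  ∎
  PD⇒DerN (app {Γ} {k} {t} {f} d df _ _ _ Γ≗) (a≐ ∷ E) =
    app (PD⇒DerN d (proj₁ E-split)) (PDM⇒DerM df (proj₂ E-split)) (≡⇒≈T ty≡) (≗E⇒≈E env≗)
    where
    E-split : Unifies g (eqs t) × Unifies g (eqsM f)
    E-split = ++⁻ (eqs t) E
    ty≡ : ty (mapT g t) ≡ mty (mapM g f) ⇒ g (pv k)
    ty≡ = begin
      ty (mapT g t)                 ≡⟨ ty-mapT g t ⟩
      g (ty t)                      ≡⟨ a≐ ⟩
      g (mty f ⇒ pv k)              ≡⟨ g-⇒ (mty f) (pv k) ⟩
      map g (mty f) ⇒ g (pv k)      ≡⟨ cong (_⇒ g (pv k)) (mty-mapM g f) ⟨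
      mty (mapM g f) ⇒ g (pv k)     ∎
    env≗ : mapE g Γ ≗E (env (mapT g t) ·E menv (mapM g f))
    env≗ y = begin
      map g (Γ y)                              ≡⟨ cong (map g) (Γ≗ y) ⟩
      map g (env t y ++ menv f y)              ≡⟨ map-++ g (env t y) (menv f y) ⟩
      map g (env t y) ++ map g (menv f y)      ≡⟨ cong₂ (λ Δ Θ → Δ y ++ Θ y) (env-mapT g t) (menv-mapM g f) ⟨
      env (mapT g t) y ++ menv (mapM g f) y    ∎
  PDM⇒DerM (many {Γ = Γ} {σ = σ} {ts = ts} ds subjs _ σ≡ Γ≗) E =
    many (All-PD⇒DerN ds E) (subj-mapL g subjs) (≡⇒≈M σ-mapped) (≗E⇒≈E env≗)
    where
    σ-mapped : map g σ ≡ map ty (mapL g ts)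
    σ-mapped = trans (cong (map g) σ≡) (sym (ty-mapL g ts))
    env≗ : mapE g Γ ≗E concatE (map env (mapL g ts))
    env≗ y = begin
      map g (Γ y)                                ≡⟨ cong (map g) (Γ≗ y) ⟩
      map g (concatE (map env ts) y)             ≡⟨ mapE-concatE g (map env ts) y ⟩
      concatE (map (mapE g) (map env ts)) y      ≡⟨ cong (λ Γs → concatE Γs y) (env-mapL g ts) ⟨
      concatE (map env (mapL g ts)) y            ∎
  All-PD⇒DerN [] _ = []
  All-PD⇒DerN {t ∷ ts} (d ∷ ds) E =
    PD⇒DerN d (proj₁ E-split) ∷ All-PD⇒DerN ds (proj₂ E-split)
    where
    E-split : Unifies g (eqs t) × Unifies g (eqsL ts)
    E-split = ++⁻ (eqs t) E

module _ (ψ : ℕ → PTy) (φ : ℕ → Ty) where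

  substT-m-substP-⇒ : ArrowHom (substT φ ∘ m ∘ substP ψ)
  substT-m-substP-⇒ σ A = cong (_⇒ _) (substTL-mL-substPL σ)
    where
    substTL-mL-substPL : ∀ σ → substTL φ (mL (substPL ψ σ)) ≡ map (substT φ ∘ m ∘ substP ψ) σ
    substTL-mL-substPL []      = refl
    substTL-mL-substPL (A ∷ σ) = cong (_ ∷_) (substTL-mL-substPL σ)

  Solves⇒Unifies : ∀ {E} → Solves ψ E → Unifies (substT φ ∘ m ∘ substP ψ) E
  Solves⇒Unifies = All.map (cong (substT φ ∘ m))

RepT-subj : ∀ {σ k t t'} → RepT σ k t t' → subj t' ≡ subj t
RepM-msubj : ∀ {σ k f f'} → RepM σ k f f' → msubj f' ≡ msubj f
RepT-subj (inAbs {x = x} r)    = cong (ƛ x) (RepT-subj r)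
RepT-subj (inAppL {f = f} r)   = cong (_· msubj f) (RepT-subj r)
RepT-subj (inAppR {t = t} r)   = cong (subj t ·_) (RepM-msubj r)
RepM-msubj (here _ _ _ _) = refl
RepM-msubj (inPrem _)     = refl

Steps-subj : ∀ {ē Π Π'} → Steps ē Π Π' → subj Π' ≡ subj Π
Steps-subj []                       = refl
Steps-subj (inj₁ (r , _) ∷ steps)   = trans (Steps-subj steps) (RepT-subj r)
Steps-subj (inj₂ (_ , refl) ∷ steps) = Steps-subj steps

Steps-PD : ∀ {ē Π Π'} → Steps ē Π Π' → PD Π → PD Π'
Steps-PD []                        d = d
Steps-PD (inj₁ (_ , d') ∷ steps)   _ = Steps-PD steps d'
Steps-PD (inj₂ (_ , refl) ∷ steps) d = Steps-PD steps d

theorem3p10 : (M : Term) (Π : DTree PTy) → IsPD M Π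
    → (ē : List Op) (Π' : DTree PTy) → Steps ē Π Π'
    → (ψ : ℕ → PTy) → Solves ψ (eqs Π')
    → (Γ : Env PTy) (a : PTy) → env Π' ≗E Γ → ty Π' ≡ a
    → (φ : ℕ → Ty)
    → DerN (mapT (substT φ ∘ m ∘ substP ψ) Π')
      × subj (mapT (substT φ ∘ m ∘ substP ψ) Π') ≡ M
      × env (mapT (substT φ ∘ m ∘ substP ψ) Π') ≗E mapE (substT φ ∘ m ∘ substP ψ) Γ
      × ty (mapT (substT φ ∘ m ∘ substP ψ) Π') ≡ substT φ (m (substP ψ a))
theorem3p10 M Π (d , subj≡M) ē Π' steps ψ solves Γ a env≗Γ ty≡a φ =
    PD⇒DerN g (substT-m-substP-⇒ ψ φ) (Steps-PD steps d) (Solves⇒Unifies ψ φ solves)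
  , trans (subj-mapT g Π') (trans (Steps-subj steps) subj≡M)
  , (λ y → trans (cong (_$ y) (env-mapT g Π')) (cong (map g) (env≗Γ y)))
  , trans (ty-mapT g Π') (cong g ty≡a)
  where
  g : PTy → Ty
  g = substT φ ∘ m ∘ substP ψ
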